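{- Let $G=(V,E_G)$ be a finite connected simple graph, let $E,F\in V$ be two distinct non-adjacent vertices, and let $G'=(V,E_G\cup\{EF\})$. For a vertex $X$ let $R_X=\{Z\in V: d_{G'}(Z,X)<d_G(Z,X)\}$. If two vertices $A,B$ both lie in $R_E$, or both lie in $R_F$, then $d_{G'}(A,B)=d_G(A,B)$; equivalently $B\notin R_A$ and $A\notin R_B$.
   Context: $d_H$ denotes shortest-path distance in the graph $H$. -}

module Defs where

open import Data.Nat using (ℕ; zero; suc; _≤_; _<_)
open import Data.Fin using (Fin)
open import Data.Product using (Σ; ∃; _×_; _,_)
open import Data.Sum using (_⊎_)
open import Relation.Binary.PropositionalEquality using (_≡_)
open import Relation.Nullary using (¬_)

record SimpleGraph (n : ℕ) : Set₁ where
  field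
    Adj    : Fin n → Fin n → Set
    symm   : ∀ {x y} → Adj x y → Adj y x
    irrefl : ∀ {x} → ¬ Adj x x
open SimpleGraph public

data Walk {n : ℕ} (G : SimpleGraph n) : Fin n → Fin n → ℕ → Set where
  here : ∀ {x} → Walk G x x zero
  step : ∀ {x y z k} → Adj G x y → Walk G y z k → Walk G x z (suc k)

IsDist : ∀ {n} → SimpleGraph n → Fin n → Fin n → ℕ → Set
IsDist G x y k = Walk G x y k × (∀ m → Walk G x y m → k ≤ m)

Connected : ∀ {n} → SimpleGraph n → Set
Connected G = ∀ x y → ∃ λ k → Walk G x y k

addEdge : ∀ {n} (G : SimpleGraph n) (e f : Fin n) → ¬ e ≡ f → SimpleGraph n
addEdge G e f e≢f = record
  { Adj    = λ x y → Adj G x y ⊎ ((x ≡ e × y ≡ f) ⊎ (x ≡ f × y ≡ e))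
  ; symm   = sy
  ; irrefl = ir
  }
  where
  open import Data.Sum using (inj₁; inj₂)
  open import Relation.Binary.PropositionalEquality using (refl; sym; trans)
  sy : ∀ {x y} → Adj G x y ⊎ ((x ≡ e × y ≡ f) ⊎ (x ≡ f × y ≡ e))
               → Adj G y x ⊎ ((y ≡ e × x ≡ f) ⊎ (y ≡ f × x ≡ e))
  sy (inj₁ a) = inj₁ (symm G a)
  sy (inj₂ (inj₁ (p , q))) = inj₂ (inj₂ (q , p))
  sy (inj₂ (inj₂ (p , q))) = inj₂ (inj₁ (q , p))
  ir : ∀ {x} → ¬ (Adj G x x ⊎ ((x ≡ e × x ≡ f) ⊎ (x ≡ f × x ≡ e)))
  ir (inj₁ a) = irrefl G a
  ir (inj₂ (inj₁ (p , q))) = e≢f (trans (sym p) q)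
  ir (inj₂ (inj₂ (p , q))) = e≢f (trans (sym q) p)

InR : ∀ {n} (G G' : SimpleGraph n) (X Z : Fin n) → Set
InR G G' X Z = Σ ℕ λ d → Σ ℕ λ d' → IsDist G Z X d × IsDist G' Z X d' × d' < d

-- A G'-walk either avoids the new edge EF or splits into G-walks x → P and
-- Q → y joined by it, where {P, Q} = {E, F}.  If Z ∈ R_P, a shortest G'-walk
-- from Z to P must enter P through the new edge, so Z has a G-walk to Q that
-- is at least 2 shorter than any G-walk from Z to P.  Hence when A, B ∈ R_P,
-- a G'-walk from A to B through the new edge can be replaced by a G-walk of
-- at most the same length that goes to Q directly from A (or from B), so the
-- new edge never shortens d(A, B).
module Submission where

open import Defs
open import Data.Nat using (ℕ; suc; _+_; _≤_; z≤n; s≤s)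
open import Data.Nat.Properties
  using (≤-reflexive; ≤-trans; ≤-antisym; <⇒≢; <⇒≱; n≤1+n; m+n≤o⇒m≤o; m+n≤o⇒n≤o;
         +-comm; +-monoˡ-≤)
open import Data.Fin using (Fin)
open import Data.Sum using (_⊎_; inj₁; inj₂)
open import Data.Product using (_×_; _,_; Σ)
open import Data.Empty using (⊥-elim)
open import Relation.Binary.PropositionalEquality using (_≡_; refl)
open import Relation.Nullary using (¬_)

module Walks {n : ℕ} (G : SimpleGraph n) where

  snoc : ∀ {x y z k} → Walk G x y k → Adj G y z → Walk G x z (suc k)
  snoc here       a = step a here
  snoc (step e w) a = step e (snoc w a)

  reverse : ∀ {x y k} → Walk G x y k → Walk G y x k
  reverse here       = here
  reverse (step e w) = snoc (reverse w) (symm G e)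

  _++_ : ∀ {x y z k j} → Walk G x y k → Walk G y z j → Walk G x z (k + j)
  here     ++ w′ = w′
  step e w ++ w′ = step e (w ++ w′)

  Direct : Fin n → Fin n → ℕ → Set
  Direct x y m = Σ ℕ λ k → Walk G x y k × k ≤ m

  -- G-walks x → P and Q → y, to be joined by an edge PQ into a walk of length ≤ m.
  Shortcut : Fin n → Fin n → Fin n → Fin n → ℕ → Set
  Shortcut P Q x y m = Σ ℕ λ a → Σ ℕ λ b → Walk G x P a × Walk G Q y b × suc (a + b) ≤ m

  Decomposition : Fin n → Fin n → Fin n → Fin n → ℕ → Set
  Decomposition P Q x y m = Direct x y m ⊎ (Shortcut P Q x y m ⊎ Shortcut Q P x y m)

  Decomposition-swap : ∀ {P Q x y m} → Decomposition P Q x y m → Decomposition Q P x y m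
  Decomposition-swap (inj₁ direct)         = inj₁ direct
  Decomposition-swap (inj₂ (inj₁ shortcut)) = inj₂ (inj₂ shortcut)
  Decomposition-swap (inj₂ (inj₂ shortcut)) = inj₂ (inj₁ shortcut)

  Shortcut-reverse : ∀ {P Q x y m} → Shortcut P Q x y m → Shortcut Q P y x m
  Shortcut-reverse (a , b , wa , wb , len) =
    b , a , reverse wb , reverse wa , ≤-trans (s≤s (≤-reflexive (+-comm b a))) len

  Direct-reverse : ∀ {x y m} → Direct x y m → Direct y x m
  Direct-reverse (k , w , len) = k , reverse w , len

  Decomposition-step : ∀ {P Q x y z m} → Adj G x y →
                       Decomposition P Q y z m → Decomposition P Q x z (suc m)
  Decomposition-step e (inj₁ (k , w , len)) = inj₁ (suc k , step e w , s≤s len)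
  Decomposition-step e (inj₂ (inj₁ (a , b , wa , wb , len))) =
    inj₂ (inj₁ (suc a , b , step e wa , wb , s≤s len))
  Decomposition-step e (inj₂ (inj₂ (a , b , wa , wb , len))) =
    inj₂ (inj₂ (suc a , b , step e wa , wb , s≤s len))

  Decomposition-cross : ∀ {P Q y m} →
                        Decomposition P Q Q y m → Decomposition P Q P y (suc m)
  Decomposition-cross (inj₁ (k , w , len)) = inj₂ (inj₁ (0 , k , here , w , s≤s len))
  Decomposition-cross (inj₂ (inj₁ (a , b , _ , wb , len))) =
    inj₂ (inj₁ (0 , b , here , wb , s≤s (m+n≤o⇒n≤o (suc a) len)))
  Decomposition-cross (inj₂ (inj₂ (a , b , _ , wb , len))) =
    inj₁ (b , wb , ≤-trans (m+n≤o⇒n≤o (suc a) len) (n≤1+n _))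

module AddEdge {n : ℕ} (G : SimpleGraph n) (E F : Fin n) (E≢F : ¬ E ≡ F) where

  open Walks G

  G′ : SimpleGraph n
  G′ = addEdge G E F E≢F

  lift : ∀ {x y k} → Walk G x y k → Walk G′ x y k
  lift here       = here
  lift (step e w) = step (inj₁ e) (lift w)

  decompose : ∀ {x y m} → Walk G′ x y m → Decomposition E F x y m
  decompose here = inj₁ (0 , here , z≤n)
  decompose (step (inj₁ e) w) = Decomposition-step e (decompose w)
  decompose (step (inj₂ (inj₁ (refl , refl))) w) = Decomposition-cross (decompose w)
  decompose (step (inj₂ (inj₂ (refl , refl))) w) =
    Decomposition-swap (Decomposition-cross (Decomposition-swap (decompose w)))

  -- {P, Q} = {E, F}; the split argument fixes which endpoint plays P.
  module Endpoint (P Q : Fin n)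
                  (split : ∀ {x y m} → Walk G′ x y m → Decomposition P Q x y m) where

    closer-to-other-end : ∀ {Z} → InR G G′ P Z →
      Σ ℕ λ a → Walk G Z Q a × (∀ m → Walk G Z P m → suc (suc a) ≤ m)
    closer-to-other-end (_ , _ , (_ , d-min) , (w′ , _) , d′<d) with split w′
    ... | inj₁ (k , w , len) = ⊥-elim (<⇒≱ d′<d (≤-trans (d-min k w) len))
    ... | inj₂ (inj₁ (a , _ , wa , _ , len)) =
      ⊥-elim (<⇒≱ d′<d (≤-trans (d-min a wa) (m+n≤o⇒m≤o a (m+n≤o⇒n≤o 1 len))))
    ... | inj₂ (inj₂ (a , _ , wa , _ , len)) =
      a , wa , λ m w → ≤-trans (s≤s (m+n≤o⇒m≤o (suc a) len)) (≤-trans d′<d (d-min m w))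

    bypass : ∀ {A y m} → InR G G′ P A → Shortcut P Q A y m → Direct A y m
    bypass A∈R (a₁ , b , wa₁ , wb , len) with closer-to-other-end A∈R
    ... | a , wa , shorter =
      a + b , wa ++ wb ,
      ≤-trans (+-monoˡ-≤ b (m+n≤o⇒n≤o 2 (shorter a₁ wa₁))) (m+n≤o⇒n≤o 1 len)

    distance-preserved : ∀ {A B} → InR G G′ P A → InR G G′ P B →
      ∀ {d d′} → IsDist G A B d → IsDist G′ A B d′ → d′ ≡ d
    distance-preserved A∈R B∈R {d} {d′} (w , d-min) (w′ , d′-min) =
      ≤-antisym (d′-min d (lift w)) (bounded (split w′))
      where
      bounded : Decomposition P Q _ _ d′ → d ≤ d′
      bounded (inj₁ (k , wk , len)) = ≤-trans (d-min k wk) len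
      bounded (inj₂ (inj₁ shortcut)) with bypass A∈R shortcut
      ... | k , wk , len = ≤-trans (d-min k wk) len
      bounded (inj₂ (inj₂ shortcut)) with Direct-reverse (bypass B∈R (Shortcut-reverse shortcut))
      ... | k , wk , len = ≤-trans (d-min k wk) len

    not-in-R : ∀ {A B} → InR G G′ P A → InR G G′ P B → ¬ InR G G′ A B
    not-in-R A∈R B∈R (_ , _ , dist , dist′ , d′<d) =
      <⇒≢ d′<d (distance-preserved B∈R A∈R dist dist′)

    distance-and-R-preserved : ∀ {A B} → InR G G′ P A → InR G G′ P B → ∀ {d d′} →
            IsDist G A B d → IsDist G′ A B d′ →
            (d′ ≡ d) × ¬ InR G G′ A B × ¬ InR G G′ B A
    distance-and-R-preserved A∈R B∈R dist dist′ =
      distance-preserved A∈R B∈R dist dist′ , not-in-R A∈R B∈R , not-in-R B∈R A∈R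

claim2 : ∀ {n} (G : SimpleGraph n) → Connected G →
    (E F : Fin n) → (E≢F : ¬ E ≡ F) → ¬ Adj G E F →
    (A B : Fin n) →
    ((InR G (addEdge G E F E≢F) E A × InR G (addEdge G E F E≢F) E B)
      ⊎ (InR G (addEdge G E F E≢F) F A × InR G (addEdge G E F E≢F) F B)) →
    (d d' : ℕ) → IsDist G A B d → IsDist (addEdge G E F E≢F) A B d' →
    (d' ≡ d) × ¬ InR G (addEdge G E F E≢F) A B × ¬ InR G (addEdge G E F E≢F) B A
claim2 G _ E F E≢F _ A B (inj₁ (A∈R , B∈R)) _ _ =
  Endpoint.distance-and-R-preserved E F decompose A∈R B∈R
  where open AddEdge G E F E≢F
claim2 G _ E F E≢F _ A B (inj₂ (A∈R , B∈R)) _ _ =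
  Endpoint.distance-and-R-preserved F E (λ w → Walks.Decomposition-swap G (decompose w)) A∈R B∈R
  where open AddEdge G E F E≢F
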